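{- Let $f:\mathbb{Z}_{>0}\to\mathbb{C}$ be any function and let $F(n)=\sum_{d\mid n} f(d)$. Then for every integer $n\ge1$, \[ \sum_{\lambda \vdash n}\sum_{\substack{\lambda_i \in \lambda \\ \lambda_i \text{ distinct}}}F(\lambda_i)=\sum_{\lambda \vdash n}\sum_{\lambda_i \in \lambda}f(\lambda_i) = \sum_{k=1}^{n}p(n-k)F(k). \]
   Context: $\lambda\vdash n$ means $\lambda$ is a partition of $n$. $\sum_{\lambda_i\in\lambda}f(\lambda_i)$ is the sum of $f$ over all parts of $\lambda$ counted with multiplicity; $\sum_{\lambda_i\in\lambda,\ \lambda_i\text{ distinct}} F(\lambda_i)$ is the sum of $F$ over the distinct part sizes of $\lambda$, each counted once. $p(m)$ is the number of partitions of $m$, with $p(0)=1$. The divisor sum runs over all positive divisors of $n$. -}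

module Defs where

open import Level using (Level)
open import Algebra.Bundles using (CommutativeMonoid)
open import Data.Nat using (ℕ; zero; suc; _∸_; _≤?_; _≟_)
open import Data.Nat.Divisibility using (_∣?_)
open import Data.List using (List; []; _∷_; [_]; map; concatMap; filter; upTo; length; foldr; deduplicate)

oneTo : ℕ → List ℕ
oneTo n = map suc (upTo n)

divisors : ℕ → List ℕ
divisors n = filter (_∣? n) (oneTo n)

-- partitionsAux fuel n m : all partitions of n (as weakly decreasing lists of
-- positive parts) whose largest part is ≤ m; fuel ≥ n guarantees completeness.
partitionsAux : ℕ → ℕ → ℕ → List (List ℕ)
partitionsAux fuel       zero    m = [ [] ]
partitionsAux zero       (suc n) m = []
partitionsAux (suc fuel) (suc n) m =
  concatMap (λ k → map (k ∷_) (partitionsAux fuel (suc n ∸ k) k))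
            (filter (_≤? m) (oneTo (suc n)))

partitions : ℕ → List (List ℕ)
partitions n = partitionsAux n n n

p : ℕ → ℕ
p n = length (partitions n)

distinctParts : List ℕ → List ℕ
distinctParts = deduplicate _≟_

module _ {c ℓ : Level} (M : CommutativeMonoid c ℓ) where
  open CommutativeMonoid M

  Σ : List Carrier → Carrier
  Σ = foldr _∙_ ε

  times : ℕ → Carrier → Carrier
  times zero    x = ε
  times (suc k) x = x ∙ times k x

  divisorSum : (ℕ → Carrier) → ℕ → Carrier
  divisorSum f n = Σ (map f (divisors n))

-- Both double sums are evaluated as Σ_{k=1}^{n} p(n-k) w(k) for a suitable weight w:
--   (A) Σ_{λ ⊢ n} Σ_{distinct parts k} g(k) = Σ_k p(n-k) g(k) for every g, since p(n-k) partitions of n contain k;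
--   (B) Σ_{λ ⊢ n} Σ_{parts k} f(k) = Σ_k p(n-k) F(k), since a part d of multiplicity ≥ j is counted by p(n-jd).
-- Both are proved for partitions of n into parts ≤ m by induction on m.  Raising the bound to suc m adds the
-- partitions suc m ∷ μ with μ a partition of n - suc m into parts ≤ suc m (partitionsUpTo-suc), and the
-- right-hand side  weighted w n m = Σ_k pUpTo(n-k, m)·w(k)  satisfies the matching recursion (weighted-suc).
-- For (B) one also needs Σ_{suc m ∣ k} pUpTo(n-k, m) = pUpTo(n - suc m, suc m) (weighted-multiples).

module Submission where

open import Defs
open import Level using (Level)
open import Algebra.Bundles using (CommutativeMonoid)
open import Data.Nat using (ℕ; zero; suc; _+_; _∸_; _≤_; _<_; z≤n; s≤s; _≤?_; _≟_)
open import Data.Nat.Properties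
open import Data.Nat.Divisibility using (_∣_; _∣?_; ∣-refl; >⇒∤; ∣m+n∣m⇒∣n; ∣m∣n⇒∣m+n)
open import Data.List using (List; []; _∷_; [_]; map; concat; concatMap; filter; upTo; length; _++_)
open import Data.List.Properties
  using (filter-all; filter-none; map-++; filter-++; ++-assoc; ++-identityʳ; concatMap-++; map-cong-local; length-++; length-map; upTo-∷ʳ; map-∘)
open import Data.List.Relation.Unary.All as All using (All; []; _∷_)
open import Data.List.Relation.Unary.All.Properties using (map⁺; applyUpTo⁺₁; filter⁺)
open import Data.Bool using (Bool; true; false; if_then_else_)
open import Data.Product using (_×_; _,_)
open import Relation.Nullary using (yes; no; does; Dec; ¬_; ¬?)
open import Relation.Unary using (Decidable)
open import Data.Empty using (⊥-elim)
open import Function using (_∘_)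
open import Relation.Binary.PropositionalEquality
  using (_≡_; refl; sym; trans; cong; cong₂; subst; module ≡-Reasoning)

oneTo-snoc : ∀ n → oneTo (suc n) ≡ oneTo n ++ [ suc n ]
oneTo-snoc n = trans (cong (map suc) (sym (upTo-∷ʳ n))) (map-++ suc (upTo n) [ n ])

oneTo-+ : ∀ a b → oneTo (a + b) ≡ oneTo a ++ map (a +_) (oneTo b)
oneTo-+ a zero rewrite +-identityʳ a = sym (++-identityʳ (oneTo a))
oneTo-+ a (suc b) = begin
    oneTo (a + suc b)                                  ≡⟨ cong oneTo (+-suc a b) ⟩
    oneTo (suc (a + b))                                ≡⟨ oneTo-snoc (a + b) ⟩
    oneTo (a + b) ++ [ suc (a + b) ]                   ≡⟨ cong (_++ [ suc (a + b) ]) (oneTo-+ a b) ⟩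
    (oneTo a ++ map (a +_) (oneTo b)) ++ [ suc (a + b) ] ≡⟨ ++-assoc (oneTo a) _ _ ⟩
    oneTo a ++ (map (a +_) (oneTo b) ++ [ suc (a + b) ]) ≡⟨ cong (λ z → oneTo a ++ (map (a +_) (oneTo b) ++ [ z ])) (sym (+-suc a b)) ⟩
    oneTo a ++ (map (a +_) (oneTo b) ++ [ a + suc b ])   ≡⟨ cong (oneTo a ++_) (sym (map-++ (a +_) (oneTo b) [ suc b ])) ⟩
    oneTo a ++ map (a +_) (oneTo b ++ [ suc b ])       ≡⟨ cong (λ z → oneTo a ++ map (a +_) z) (sym (oneTo-snoc b)) ⟩
    oneTo a ++ map (a +_) (oneTo (suc b))              ∎
  where open ≡-Reasoning

oneTo-split : ∀ {a n} → a ≤ n → oneTo n ≡ oneTo a ++ map (a +_) (oneTo (n ∸ a))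
oneTo-split {a} {n} a≤n = trans (cong oneTo (sym (m+[n∸m]≡n a≤n))) (oneTo-+ a (n ∸ a))

InRange : ℕ → ℕ → Set
InRange n k = 1 ≤ k × k ≤ n

oneTo-inRange : ∀ n → All (InRange n) (oneTo n)
oneTo-inRange n = map⁺ (applyUpTo⁺₁ (λ i → i) n (λ i<n → s≤s z≤n , i<n))

filter-≤-oneTo-below : ∀ {m n} → n ≤ m → filter (_≤? m) (oneTo n) ≡ oneTo n
filter-≤-oneTo-below {m} {n} n≤m = filter-all (_≤? m) (All.map (λ (_ , k≤n) → ≤-trans k≤n n≤m) (oneTo-inRange n))

filter-≤-oneTo-above : ∀ {m n} → m ≤ n → filter (_≤? m) (oneTo n) ≡ oneTo m
filter-≤-oneTo-above {m} {n} m≤n = begin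
  filter (_≤? m) (oneTo n)                                         ≡⟨ cong (filter (_≤? m)) (oneTo-split m≤n) ⟩
  filter (_≤? m) (oneTo m ++ map (m +_) (oneTo (n ∸ m)))           ≡⟨ filter-++ (_≤? m) (oneTo m) _ ⟩
  filter (_≤? m) (oneTo m) ++ filter (_≤? m) (map (m +_) (oneTo (n ∸ m)))
    ≡⟨ cong₂ _++_ (filter-≤-oneTo-below ≤-refl) (filter-none (_≤? m) (map⁺ (All.map (λ (1≤k , _) → m+n≰m 1≤k) (oneTo-inRange (n ∸ m))))) ⟩
  oneTo m ++ []                                                    ≡⟨ ++-identityʳ (oneTo m) ⟩
  oneTo m                                                          ∎
  where
  open ≡-Reasoning
  m+n≰m : ∀ {k} → 1 ≤ k → ¬ (m + k ≤ m)
  m+n≰m 1≤k h = <-irrefl refl (<-≤-trans (m<m+n m 1≤k) h)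

∸-swap : ∀ n a b → n ∸ a ∸ b ≡ n ∸ b ∸ a
∸-swap n a b = trans (∸-+-assoc n a b) (trans (cong (n ∸_) (+-comm a b)) (sym (∸-+-assoc n b a)))

∸-swap-≤ : ∀ {n a b} → b ≤ n → a ≤ n ∸ b → b ≤ n ∸ a
∸-swap-≤ {n} {a} {b} b≤n a≤n∸b = m+n≤o⇒m≤o∸n b (subst (_≤ n) (+-comm a b) (m≤o∸n⇒m+n≤o a b≤n a≤n∸b))

∸-past-remainder : ∀ {n m k} → suc m ≤ n → 1 ≤ k → n ∸ (n ∸ suc m + k) ≤ m
∸-past-remainder {n} {m} {k} m<n 1≤k = ≤-trans
  (≤-reflexive (trans (sym (∸-+-assoc n (n ∸ suc m) k)) (cong (_∸ k) (m∸[m∸n]≡n m<n))))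
  (∸-monoʳ-≤ (suc m) 1≤k)

∤-below : ∀ {j k} → 1 ≤ k → k < j → ¬ (j ∣ k)
∤-below {k = suc _} _ k<j = >⇒∤ k<j

if-yes : ∀ {a b} {A : Set a} {B : Set b} (d : Dec A) {x y : B} → A → (if does d then x else y) ≡ x
if-yes (yes _) _ = refl
if-yes (no ¬a) a = ⊥-elim (¬a a)

if-no : ∀ {a b} {A : Set a} {B : Set b} (d : Dec A) {x y : B} → ¬ A → (if does d then x else y) ≡ y
if-no (yes a) ¬a = ⊥-elim (¬a a)
if-no (no _) _ = refl

partitionsUpTo : ℕ → ℕ → List (List ℕ)
partitionsUpTo n m = partitionsAux n n m

pUpTo : ℕ → ℕ → ℕ
pUpTo n m = length (partitionsUpTo n m)

partitionsAux-fuel : ∀ f₁ f₂ n m → n ≤ f₁ → n ≤ f₂ → partitionsAux f₁ n m ≡ partitionsAux f₂ n m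
partitionsAux-fuel f₁ f₂ zero m _ _ = refl
partitionsAux-fuel (suc f₁) (suc f₂) (suc n) m (s≤s n≤f₁) (s≤s n≤f₂) =
  cong concat (map-cong-local (filter⁺ (_≤? m) (All.map same (oneTo-inRange (suc n)))))
  where
  same : ∀ {k} → InRange (suc n) k →
    map (k ∷_) (partitionsAux f₁ (suc n ∸ k) k) ≡ map (k ∷_) (partitionsAux f₂ (suc n ∸ k) k)
  same {suc k} _ = cong (map (suc k ∷_))
    (partitionsAux-fuel f₁ f₂ (n ∸ k) (suc k) (≤-trans (m∸n≤m n k) n≤f₁) (≤-trans (m∸n≤m n k) n≤f₂))

startingWith : ℕ → ℕ → List (List ℕ)
startingWith n k = map (k ∷_) (partitionsAux n (suc n ∸ k) k)

startingWith-suc : ∀ n m → startingWith n (suc m) ≡ map (suc m ∷_) (partitionsUpTo (n ∸ m) (suc m))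
startingWith-suc n m = cong (map (suc m ∷_)) (partitionsAux-fuel n (n ∸ m) (n ∸ m) (suc m) (m∸n≤m n m) ≤-refl)

partitionsUpTo-large : ∀ n m → n ≤ m → partitionsUpTo n m ≡ partitions n
partitionsUpTo-large zero m _ = refl
partitionsUpTo-large (suc n) m n<m =
  cong (concatMap (startingWith n)) (trans (filter-≤-oneTo-below n<m) (sym (filter-≤-oneTo-below ≤-refl)))

pUpTo-large : ∀ n m → n ≤ m → pUpTo n m ≡ p n
pUpTo-large n m n≤m = cong length (partitionsUpTo-large n m n≤m)

partitionsUpTo-zero : ∀ n → partitionsUpTo (suc n) 0 ≡ []
partitionsUpTo-zero n = cong (concatMap (startingWith n)) (filter-≤-oneTo-above {n = suc n} z≤n)

topBlock : ℕ → ℕ → List (List ℕ)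
topBlock n m = if does (suc m ≤? n) then map (suc m ∷_) (partitionsUpTo (n ∸ suc m) (suc m)) else []

partitionsUpTo-suc : ∀ n m → partitionsUpTo n (suc m) ≡ partitionsUpTo n m ++ topBlock n m
partitionsUpTo-suc zero m = refl
partitionsUpTo-suc (suc n) m with suc m ≤? suc n
... | yes m<n = begin
  concatMap S (filter (_≤? suc m) (oneTo (suc n)))   ≡⟨ cong (concatMap S) (filter-≤-oneTo-above m<n) ⟩
  concatMap S (oneTo (suc m))                         ≡⟨ cong (concatMap S) (oneTo-snoc m) ⟩
  concatMap S (oneTo m ++ [ suc m ])                  ≡⟨ concatMap-++ S (oneTo m) [ suc m ] ⟩
  concatMap S (oneTo m) ++ (S (suc m) ++ [])          ≡⟨ cong₂ _++_ (cong (concatMap S) (sym (filter-≤-oneTo-above (<⇒≤ m<n))))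
                                                                   (trans (++-identityʳ _) (startingWith-suc n m)) ⟩
  partitionsUpTo (suc n) m ++ map (suc m ∷_) (partitionsUpTo (n ∸ m) (suc m))
                                                      ≡⟨ cong (partitionsUpTo (suc n) m ++_) (sym (if-yes (suc m ≤? suc n) m<n)) ⟩
  partitionsUpTo (suc n) m ++ topBlock (suc n) m      ∎
  where
  open ≡-Reasoning
  S : ℕ → List (List ℕ)
  S = startingWith n
... | no m≮n = begin
  concatMap S (filter (_≤? suc m) (oneTo (suc n)))   ≡⟨ cong (concatMap S) (trans (filter-≤-oneTo-below n≤m+1)
                                                           (sym (filter-≤-oneTo-below (≤-pred (≰⇒> m≮n))))) ⟩
  partitionsUpTo (suc n) m                            ≡⟨ sym (++-identityʳ _) ⟩
  partitionsUpTo (suc n) m ++ []                      ≡⟨ cong (partitionsUpTo (suc n) m ++_) (sym (if-no (suc m ≤? suc n) m≮n)) ⟩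
  partitionsUpTo (suc n) m ++ topBlock (suc n) m      ∎
  where
  open ≡-Reasoning
  S : ℕ → List (List ℕ)
  S = startingWith n
  n≤m+1 : suc n ≤ suc m
  n≤m+1 = <⇒≤ (≰⇒> m≮n)

topCount : ℕ → ℕ → ℕ
topCount n m = length (topBlock n m)

pUpTo-suc : ∀ n m → pUpTo n (suc m) ≡ pUpTo n m + topCount n m
pUpTo-suc n m = trans (cong length (partitionsUpTo-suc n m)) (length-++ (partitionsUpTo n m))

topCount-yes : ∀ {n m} → suc m ≤ n → topCount n m ≡ pUpTo (n ∸ suc m) (suc m)
topCount-yes {n} {m} m<n =
  trans (cong length (if-yes (suc m ≤? n) m<n)) (length-map (suc m ∷_) (partitionsUpTo (n ∸ suc m) (suc m)))

topCount-no : ∀ {n m} → ¬ (suc m ≤ n) → topCount n m ≡ 0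
topCount-no {n} {m} m≮n = cong length (if-no (suc m ≤? n) m≮n)

module Sums {a ℓ : Level} (M : CommutativeMonoid a ℓ) where
  open CommutativeMonoid M
    using (Carrier; _≈_; _∙_; ε; assoc; identityˡ; identityʳ; ∙-cong; ∙-congˡ; ∙-congʳ; setoid; commutativeSemigroup)
    renaming (refl to ≈-refl; sym to ≈-sym; trans to ≈-trans; reflexive to ≈-reflexive)
  open import Algebra.Properties.CommutativeMonoid.Mult M using (×-congʳ; ×-homo-+; ×-distrib-+) renaming (_×_ to _·_)
  open import Algebra.Properties.CommutativeSemigroup commutativeSemigroup using (interchange; x∙yz≈xz∙y)
  open import Relation.Binary.Reasoning.Setoid setoid

  ΣM : {A : Set} → (A → Carrier) → List A → Carrier
  ΣM g xs = Σ M (map g xs)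

  Σ-++ : ∀ {A : Set} (g : A → Carrier) xs ys → ΣM g (xs ++ ys) ≈ ΣM g xs ∙ ΣM g ys
  Σ-++ g []       ys = ≈-sym (identityˡ _)
  Σ-++ g (x ∷ xs) ys = ≈-trans (∙-congˡ (Σ-++ g xs ys)) (≈-sym (assoc _ _ _))

  Σ-congᴬ : ∀ {A : Set} {g h : A → Carrier} {xs} → All (λ x → g x ≈ h x) xs → ΣM g xs ≈ ΣM h xs
  Σ-congᴬ []       = ≈-refl
  Σ-congᴬ (e ∷ es) = ∙-cong e (Σ-congᴬ es)

  Σ-cong : ∀ {A : Set} {g h : A → Carrier} → (∀ x → g x ≈ h x) → ∀ xs → ΣM g xs ≈ ΣM h xs
  Σ-cong e xs = Σ-congᴬ (All.universal e xs)

  Σ-oneTo-cong : ∀ {g h : ℕ → Carrier} n → (∀ {k} → InRange n k → g k ≈ h k) → ΣM g (oneTo n) ≈ ΣM h (oneTo n)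
  Σ-oneTo-cong n e = Σ-congᴬ (All.map e (oneTo-inRange n))

  Σ-ε : ∀ {A : Set} {g : A → Carrier} {xs} → All (λ x → g x ≈ ε) xs → ΣM g xs ≈ ε
  Σ-ε []       = ≈-refl
  Σ-ε (e ∷ es) = ≈-trans (∙-cong e (Σ-ε es)) (identityˡ ε)

  Σ-∙ : ∀ {A : Set} (g h : A → Carrier) xs → ΣM (λ x → g x ∙ h x) xs ≈ ΣM g xs ∙ ΣM h xs
  Σ-∙ g h []       = ≈-sym (identityˡ ε)
  Σ-∙ g h (x ∷ xs) = ≈-trans (∙-congˡ (Σ-∙ g h xs)) (interchange (g x) (h x) _ _)

  Σ-prefix : ∀ {A : Set} (y : Carrier) (h : A → Carrier) xs → ΣM (λ x → y ∙ h x) xs ≈ length xs · y ∙ ΣM h xs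
  Σ-prefix y h []       = ≈-sym (identityˡ ε)
  Σ-prefix y h (x ∷ xs) = ≈-trans (∙-congˡ (Σ-prefix y h xs)) (interchange y (h x) _ _)

  Σ-map : ∀ {A B : Set} (g : B → Carrier) (h : A → B) xs → ΣM g (map h xs) ≡ ΣM (λ x → g (h x)) xs
  Σ-map g h xs = cong (Σ M) (sym (map-∘ xs))

  Σ-oneTo-snoc : ∀ (g : ℕ → Carrier) n → ΣM g (oneTo (suc n)) ≈ ΣM g (oneTo n) ∙ (g (suc n) ∙ ε)
  Σ-oneTo-snoc g n = ≈-trans (≈-reflexive (cong (ΣM g) (oneTo-snoc n))) (Σ-++ g (oneTo n) [ suc n ])

  Σ-oneTo-split : ∀ (g : ℕ → Carrier) {a n} → a ≤ n →
    ΣM g (oneTo n) ≈ ΣM g (oneTo a) ∙ ΣM (λ k → g (a + k)) (oneTo (n ∸ a))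
  Σ-oneTo-split g {a} {n} a≤n = begin
    ΣM g (oneTo n)                                   ≡⟨ cong (ΣM g) (oneTo-split a≤n) ⟩
    ΣM g (oneTo a ++ map (a +_) (oneTo (n ∸ a)))     ≈⟨ Σ-++ g (oneTo a) _ ⟩
    ΣM g (oneTo a) ∙ ΣM g (map (a +_) (oneTo (n ∸ a))) ≡⟨ cong (ΣM g (oneTo a) ∙_) (Σ-map g (a +_) (oneTo (n ∸ a))) ⟩
    ΣM g (oneTo a) ∙ ΣM (λ k → g (a + k)) (oneTo (n ∸ a)) ∎

  when : Bool → Carrier → Carrier
  when b x = if b then x else ε

  Σ-filter : ∀ {A : Set} {q} {P : A → Set q} (P? : Decidable P) (g : A → Carrier) xs →
    ΣM g (filter P? xs) ≈ ΣM (λ x → when (does (P? x)) (g x)) xs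
  Σ-filter P? g [] = ≈-refl
  Σ-filter P? g (x ∷ xs) with does (P? x)
  ... | true  = ∙-congˡ (Σ-filter P? g xs)
  ... | false = ≈-trans (Σ-filter P? g xs) (≈-sym (identityˡ _))

  when-swap : ∀ a b x → when a (when b x) ≡ when b (when a x)
  when-swap true  true  x = refl
  when-swap true  false x = refl
  when-swap false true  x = refl
  when-swap false false x = refl

  ·-ε : ∀ n → n · ε ≈ ε
  ·-ε zero    = ≈-refl
  ·-ε (suc n) = ≈-trans (identityˡ _) (·-ε n)

  ·-when : ∀ n b x → n · when b x ≈ when b (n · x)
  ·-when n true  x = ≈-refl
  ·-when n false x = ·-ε n

  _↾_ : (ℕ → Carrier) → ℕ → ℕ → Carrier
  (g ↾ m) k = when (does (k ≤? m)) (g k)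

  at : ℕ → (ℕ → Carrier) → ℕ → Carrier
  at j g k = when (does (k ≟ j)) (g k)

  erase : ℕ → (ℕ → Carrier) → ℕ → Carrier
  erase j g k = when (does (¬? (j ≟ k))) (g k)

  ↾-large : ∀ (g : ℕ → Carrier) {m k} → k ≤ m → (g ↾ m) k ≡ g k
  ↾-large g {m} {k} k≤m = if-yes (k ≤? m) k≤m

  ↾-zero : ∀ (g : ℕ → Carrier) {k} → 1 ≤ k → (g ↾ 0) k ≡ ε
  ↾-zero g {k} 1≤k = if-no (k ≤? 0) (<⇒≱ 1≤k)

  ↾-suc : ∀ (g : ℕ → Carrier) m k → (g ↾ suc m) k ≈ (g ↾ m) k ∙ at (suc m) g k
  ↾-suc g m k with k ≤? m | k ≟ suc m
  ... | yes k≤m | yes refl = ⊥-elim (<-irrefl refl k≤m)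
  ... | yes k≤m | no k≢m+1 = begin
    (g ↾ suc m) k ≡⟨ ↾-large g (m≤n⇒m≤1+n k≤m) ⟩
    g k           ≈⟨ identityʳ (g k) ⟨
    g k ∙ ε       ≡⟨ cong₂ _∙_ (↾-large g k≤m) (if-no (k ≟ suc m) k≢m+1) ⟨
    (g ↾ m) k ∙ at (suc m) g k ∎
  ... | no k≰m  | yes refl = begin
    (g ↾ suc m) k ≡⟨ ↾-large g {suc m} {suc m} ≤-refl ⟩
    g k           ≈⟨ identityˡ (g k) ⟨
    ε ∙ g k       ≡⟨ cong₂ _∙_ (if-no (k ≤? m) k≰m) (if-yes (k ≟ suc m) refl) ⟨
    (g ↾ m) k ∙ at (suc m) g k ∎
  ... | no k≰m  | no k≢m+1 = begin
    (g ↾ suc m) k ≡⟨ if-no (k ≤? suc m) (λ k≤m+1 → k≢m+1 (≤-antisym k≤m+1 (≰⇒> k≰m))) ⟩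
    ε             ≈⟨ identityˡ ε ⟨
    ε ∙ ε         ≡⟨ cong₂ _∙_ (if-no (k ≤? m) k≰m) (if-no (k ≟ suc m) k≢m+1) ⟨
    (g ↾ m) k ∙ at (suc m) g k ∎

  erase-↾ : ∀ (g : ℕ → Carrier) m k → (erase (suc m) g ↾ suc m) k ≡ (g ↾ m) k
  erase-↾ g m k with k ≤? m | suc m ≟ k
  ... | yes k≤m | yes refl = ⊥-elim (<-irrefl refl k≤m)
  ... | yes k≤m | no m+1≢k =
    trans (↾-large (erase (suc m) g) (m≤n⇒m≤1+n k≤m)) (trans (if-yes (¬? (suc m ≟ k)) m+1≢k) (sym (↾-large g k≤m)))
  ... | no k≰m  | yes refl =
    trans (↾-large (erase (suc m) g) {suc m} {suc m} ≤-refl) (trans (if-no (¬? (suc m ≟ suc m)) (λ ne → ne refl)) (sym (if-no (k ≤? m) k≰m)))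
  ... | no k≰m  | no m+1≢k =
    trans (if-no (k ≤? suc m) (λ k≤m+1 → m+1≢k (≤-antisym (≰⇒> k≰m) k≤m+1))) (sym (if-no (k ≤? m) k≰m))

  Σ-at : ∀ (h : ℕ → Carrier) {j n} → 1 ≤ j → j ≤ n → ΣM (at j h) (oneTo n) ≈ h j
  Σ-at h {suc i} {n} _ j≤n = begin
    ΣM (at j h) (oneTo n)                                              ≈⟨ Σ-oneTo-split (at j h) j≤n ⟩
    ΣM (at j h) (oneTo j) ∙ ΣM (λ k → at j h (j + k)) (oneTo (n ∸ j)) ≈⟨ ∙-cong (Σ-oneTo-snoc (at j h) i) (Σ-ε after) ⟩
    (ΣM (at j h) (oneTo i) ∙ (at j h j ∙ ε)) ∙ ε                       ≈⟨ identityʳ _ ⟩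
    ΣM (at j h) (oneTo i) ∙ (at j h j ∙ ε)                             ≈⟨ ∙-cong (Σ-ε before) (identityʳ _) ⟩
    ε ∙ at j h j                                                       ≈⟨ identityˡ _ ⟩
    at j h j                                                           ≡⟨ if-yes (j ≟ j) refl ⟩
    h j                                                                ∎
    where
    j : ℕ
    j = suc i
    before : All (λ k → at j h k ≈ ε) (oneTo i)
    before = All.map (λ {k} (_ , k≤i) → ≈-reflexive (if-no (k ≟ j) (<⇒≢ (s≤s k≤i)))) (oneTo-inRange i)
    after : All (λ k → at j h (j + k) ≈ ε) (oneTo (n ∸ j))
    after = All.map (λ {k} (1≤k , _) → ≈-reflexive (if-no (j + k ≟ j) (λ e → <⇒≢ (m<m+n j 1≤k) (sym e)))) (oneTo-inRange (n ∸ j))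

  divisors-inRange : ∀ k → All (InRange k) (divisors k)
  divisors-inRange k = filter⁺ (_∣? k) (oneTo-inRange k)

  divisorSum-at : ∀ (f : ℕ → Carrier) {j k} → 1 ≤ j → 1 ≤ k → divisorSum M (at j f) k ≈ when (does (j ∣? k)) (f j)
  divisorSum-at f {j} {k} 1≤j 1≤k = begin
    divisorSum M (at j f) k                                ≈⟨ Σ-filter (_∣? k) (at j f) (oneTo k) ⟩
    ΣM (λ d → when (does (d ∣? k)) (at j f d)) (oneTo k)   ≈⟨ Σ-cong (λ d → ≈-reflexive (when-swap (does (d ∣? k)) (does (d ≟ j)) (f d))) (oneTo k) ⟩
    ΣM (at j dividing) (oneTo k)                           ≈⟨ pick (j ≤? k) ⟩
    dividing j                                             ∎
    where
    dividing : ℕ → Carrier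
    dividing d = when (does (d ∣? k)) (f d)
    pick : Dec (j ≤ k) → ΣM (at j dividing) (oneTo k) ≈ dividing j
    pick (yes j≤k) = Σ-at dividing 1≤j j≤k
    pick (no j≰k)  = ≈-trans (Σ-ε (All.map (λ {d} (_ , d≤k) → ≈-reflexive (if-no (d ≟ j) (λ { refl → j≰k d≤k }))) (oneTo-inRange k)))
                             (≈-reflexive (sym (if-no (j ∣? k) (∤-below 1≤k (≰⇒> j≰k)))))

  divisorSum-↾-suc : ∀ (f : ℕ → Carrier) m {k} → 1 ≤ k →
    divisorSum M (f ↾ suc m) k ≈ divisorSum M (f ↾ m) k ∙ when (does (suc m ∣? k)) (f (suc m))
  divisorSum-↾-suc f m {k} 1≤k = ≈-trans (Σ-cong (↾-suc f m) (divisors k))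
    (≈-trans (Σ-∙ (f ↾ m) (at (suc m) f) (divisors k)) (∙-congˡ (divisorSum-at f (s≤s z≤n) 1≤k)))

  divisorSum-↾-zero : ∀ (f : ℕ → Carrier) k → divisorSum M (f ↾ 0) k ≈ ε
  divisorSum-↾-zero f k = Σ-ε (All.map (λ (1≤d , _) → ≈-reflexive (↾-zero f 1≤d)) (divisors-inRange k))

  divisorSum-↾-large : ∀ (f : ℕ → Carrier) {m k} → k ≤ m → divisorSum M (f ↾ m) k ≈ divisorSum M f k
  divisorSum-↾-large f k≤m =
    Σ-congᴬ (All.map (λ (_ , d≤k) → ≈-reflexive (↾-large f (≤-trans d≤k k≤m))) (divisors-inRange _))

  -- weighted w n m = Σ_{k=1}^{n} pUpTo(n-k, m) · w(k): the right-hand side of the identities,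
  -- with pUpTo(n-k, m) counting the partitions of n (parts ≤ m) that contain a part k.
  weighted : (ℕ → Carrier) → ℕ → ℕ → Carrier
  weighted w n m = ΣM (λ k → pUpTo (n ∸ k) m · w k) (oneTo n)

  weighted-cong : ∀ {v w : ℕ → Carrier} n m → (∀ {k} → InRange n k → v k ≈ w k) → weighted v n m ≈ weighted w n m
  weighted-cong n m e = Σ-oneTo-cong n (λ {k} r → ×-congʳ (pUpTo (n ∸ k) m) (e r))

  weighted-ε : ∀ {w : ℕ → Carrier} n m → (∀ {k} → InRange n k → w k ≈ ε) → weighted w n m ≈ ε
  weighted-ε n m e = Σ-ε (All.map (λ {k} r → ≈-trans (×-congʳ (pUpTo (n ∸ k) m) (e r)) (·-ε (pUpTo (n ∸ k) m))) (oneTo-inRange n))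

  weighted-∙ : ∀ (v w : ℕ → Carrier) n m → weighted (λ k → v k ∙ w k) n m ≈ weighted v n m ∙ weighted w n m
  weighted-∙ v w n m = ≈-trans (Σ-cong (λ k → ×-distrib-+ (v k) (w k) (pUpTo (n ∸ k) m)) (oneTo n)) (Σ-∙ _ _ (oneTo n))

  weighted-large : ∀ (w : ℕ → Carrier) {n m} → n ≤ m → weighted w n m ≈ ΣM (λ k → p (n ∸ k) · w k) (oneTo n)
  weighted-large w {n} {m} n≤m =
    Σ-cong (λ k → ≈-reflexive (cong (_· w k) (pUpTo-large (n ∸ k) m (≤-trans (m∸n≤m n k) n≤m)))) (oneTo n)

  weighted-stable : ∀ {v w : ℕ → Carrier} {n m} → n ≤ m → (∀ {k} → InRange n k → v k ≈ w k) →
    weighted v n m ≈ weighted w n (suc m)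
  weighted-stable {v} {w} {n} n≤m e = begin
    weighted v n _                          ≈⟨ weighted-large v n≤m ⟩
    ΣM (λ k → p (n ∸ k) · v k) (oneTo n)    ≈⟨ Σ-oneTo-cong n (λ {k} r → ×-congʳ (p (n ∸ k)) (e r)) ⟩
    ΣM (λ k → p (n ∸ k) · w k) (oneTo n)    ≈⟨ weighted-large w (m≤n⇒m≤1+n n≤m) ⟨
    weighted w n _                          ∎

  Σ-topCount : ∀ (w : ℕ → Carrier) {n m} → suc m ≤ n →
    ΣM (λ k → topCount (n ∸ k) m · w k) (oneTo n) ≈ weighted w (n ∸ suc m) (suc m)
  Σ-topCount w {n} {m} m<n = begin
    ΣM T (oneTo n)                                          ≈⟨ Σ-oneTo-split T (m∸n≤m n (suc m)) ⟩
    ΣM T (oneTo R) ∙ ΣM (λ k → T (R + k)) (oneTo (n ∸ R))   ≈⟨ ∙-cong (Σ-oneTo-cong R inside) (Σ-ε outside) ⟩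
    weighted w R (suc m) ∙ ε                                ≈⟨ identityʳ _ ⟩
    weighted w R (suc m)                                    ∎
    where
    R : ℕ
    R = n ∸ suc m
    T : ℕ → Carrier
    T k = topCount (n ∸ k) m · w k
    inside : ∀ {k} → InRange R k → T k ≈ pUpTo (R ∸ k) (suc m) · w k
    inside {k} (_ , k≤R) = ≈-reflexive (cong (_· w k)
      (trans (topCount-yes (∸-swap-≤ m<n k≤R)) (cong (λ r → pUpTo r (suc m)) (∸-swap n k (suc m)))))
    outside : All (λ k → T (R + k) ≈ ε) (oneTo (n ∸ R))
    outside = All.map (λ {k} (1≤k , _) → ≈-reflexive (cong (_· w (R + k))
      (topCount-no (λ m<n∸R+k → <-irrefl refl (≤-trans m<n∸R+k (∸-past-remainder m<n 1≤k))))))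
      (oneTo-inRange (n ∸ R))

  weighted-suc : ∀ (w : ℕ → Carrier) {n m} → suc m ≤ n →
    weighted w n (suc m) ≈ weighted w n m ∙ weighted w (n ∸ suc m) (suc m)
  weighted-suc w {n} {m} m<n = begin
    weighted w n (suc m)
      ≈⟨ Σ-cong (λ k → ≈-trans (≈-reflexive (cong (_· w k) (pUpTo-suc (n ∸ k) m))) (×-homo-+ (w k) (pUpTo (n ∸ k) m) (topCount (n ∸ k) m))) (oneTo n) ⟩
    ΣM (λ k → pUpTo (n ∸ k) m · w k ∙ topCount (n ∸ k) m · w k) (oneTo n)
      ≈⟨ Σ-∙ _ _ (oneTo n) ⟩
    weighted w n m ∙ ΣM (λ k → topCount (n ∸ k) m · w k) (oneTo n)
      ≈⟨ ∙-congˡ (Σ-topCount w m<n) ⟩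
    weighted w n m ∙ weighted w (n ∸ suc m) (suc m) ∎

  weighted-at : ∀ (g : ℕ → Carrier) {j n} m → 1 ≤ j → j ≤ n → weighted (at j g) n m ≈ pUpTo (n ∸ j) m · g j
  weighted-at g {j} {n} m 1≤j j≤n = ≈-trans
    (Σ-cong (λ k → ·-when (pUpTo (n ∸ k) m) (does (k ≟ j)) (g k)) (oneTo n))
    (Σ-at (λ k → pUpTo (n ∸ k) m · g k) 1≤j j≤n)

  multiplesOf : ℕ → Carrier → ℕ → Carrier
  multiplesOf d x k = when (does (d ∣? k)) x

  multiplesOf-periodic : ∀ d x k → multiplesOf d x (d + k) ≡ multiplesOf d x k
  multiplesOf-periodic d x k with d ∣? k
  ... | yes d∣k = if-yes (d ∣? (d + k)) (∣m∣n⇒∣m+n ∣-refl d∣k)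
  ... | no d∤k  = if-no (d ∣? (d + k)) (λ d∣d+k → d∤k (∣m+n∣m⇒∣n d∣d+k ∣-refl))

  multiplesOf-first : ∀ {d k} x → InRange d k → multiplesOf d x k ≡ at d (λ _ → x) k
  multiplesOf-first {d} {k} x (1≤k , k≤d) with k ≟ d
  ... | yes refl = trans (if-yes (k ∣? k) ∣-refl) (sym (if-yes (k ≟ k) refl))
  ... | no k≢d   = trans (if-no (d ∣? k) (∤-below 1≤k (≤∧≢⇒< k≤d k≢d))) (sym (if-no (k ≟ d) k≢d))

  -- Σ_{suc m ∣ k ≤ n} pUpTo(n-k, m) = pUpTo(n - suc m, suc m): a partition of n - suc m into
  -- parts ≤ suc m is a partition into parts ≤ m together with some number of parts suc m.
  -- (b bounds n, for termination.)
  weighted-multiples : ∀ b x {n m} → n ≤ b → suc m ≤ n →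
    weighted (multiplesOf (suc m) x) n m ≈ pUpTo (n ∸ suc m) (suc m) · x
  weighted-multiples zero    x {suc _} () _
  weighted-multiples (suc b) x {n} {m} n≤b+1 m<n = begin
    weighted c n m                                         ≈⟨ Σ-oneTo-split T m<n ⟩
    ΣM T (oneTo d) ∙ ΣM (λ k → T (d + k)) (oneTo R)        ≈⟨ ∙-cong firstPeriod laterPeriods ⟩
    pUpTo R m · x ∙ topCount R m · x                       ≈⟨ ×-homo-+ x (pUpTo R m) (topCount R m) ⟨
    (pUpTo R m + topCount R m) · x                         ≡⟨ cong (_· x) (pUpTo-suc R m) ⟨
    pUpTo R (suc m) · x                                    ∎
    where
    d : ℕ
    d = suc m
    R : ℕ
    R = n ∸ d
    c : ℕ → Carrier
    c = multiplesOf d x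
    T : ℕ → Carrier
    T k = pUpTo (n ∸ k) m · c k
    firstPeriod : ΣM T (oneTo d) ≈ pUpTo R m · x
    firstPeriod = ≈-trans
      (Σ-oneTo-cong d (λ {k} r → ≈-trans (≈-reflexive (cong (pUpTo (n ∸ k) m ·_) (multiplesOf-first x r)))
                                         (·-when (pUpTo (n ∸ k) m) (does (k ≟ d)) x)))
      (Σ-at (λ k → pUpTo (n ∸ k) m · x) (s≤s z≤n) ≤-refl)
    rest : Dec (d ≤ R) → weighted c R m ≈ topCount R m · x
    rest (yes m<R) = ≈-trans (weighted-multiples b x (≤-trans (∸-monoʳ-≤ n (s≤s z≤n)) (∸-monoˡ-≤ 1 n≤b+1)) m<R)
                             (≈-reflexive (cong (_· x) (sym (topCount-yes m<R))))
    rest (no m≮R)  = ≈-trans (weighted-ε R m (λ (1≤k , k≤R) → ≈-reflexive (if-no (d ∣? _) (∤-below 1≤k (≤-<-trans k≤R (≰⇒> m≮R))))))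
                             (≈-reflexive (cong (_· x) (sym (topCount-no m≮R))))
    laterPeriods : ΣM (λ k → T (d + k)) (oneTo R) ≈ topCount R m · x
    laterPeriods = ≈-trans
      (Σ-cong (λ k → ≈-reflexive (cong₂ _·_ (cong (λ r → pUpTo r m) (sym (∸-+-assoc n d k))) (multiplesOf-periodic d x k))) (oneTo R))
      (rest (d ≤? R))

  Σ-partitions-suc : ∀ (φ : List ℕ → Carrier) {n m} → suc m ≤ n →
    ΣM φ (partitionsUpTo n (suc m)) ≈
      ΣM φ (partitionsUpTo n m) ∙ ΣM (λ μ → φ (suc m ∷ μ)) (partitionsUpTo (n ∸ suc m) (suc m))
  Σ-partitions-suc φ {n} {m} m<n = begin
    ΣM φ (partitionsUpTo n (suc m))                  ≡⟨ cong (ΣM φ) (partitionsUpTo-suc n m) ⟩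
    ΣM φ (partitionsUpTo n m ++ topBlock n m)        ≈⟨ Σ-++ φ (partitionsUpTo n m) (topBlock n m) ⟩
    ΣM φ (partitionsUpTo n m) ∙ ΣM φ (topBlock n m)  ≡⟨ cong (λ t → ΣM φ (partitionsUpTo n m) ∙ ΣM φ t) (if-yes (suc m ≤? n) m<n) ⟩
    ΣM φ (partitionsUpTo n m) ∙ ΣM φ (map (suc m ∷_) Q) ≡⟨ cong (ΣM φ (partitionsUpTo n m) ∙_) (Σ-map φ (suc m ∷_) Q) ⟩
    ΣM φ (partitionsUpTo n m) ∙ ΣM (λ μ → φ (suc m ∷ μ)) Q ∎
    where
    Q : List (List ℕ)
    Q = partitionsUpTo (n ∸ suc m) (suc m)

  Σ-partitions-stable : ∀ (φ : List ℕ → Carrier) {n m} → n ≤ m →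
    ΣM φ (partitionsUpTo n (suc m)) ≡ ΣM φ (partitionsUpTo n m)
  Σ-partitions-stable φ {n} {m} n≤m = cong (ΣM φ)
    (trans (partitionsUpTo-large n (suc m) (m≤n⇒m≤1+n n≤m)) (sym (partitionsUpTo-large n m n≤m)))

  distinctSum : (ℕ → Carrier) → List ℕ → Carrier
  distinctSum g lam = ΣM g (distinctParts lam)

  partSum : (ℕ → Carrier) → List ℕ → Carrier
  partSum f lam = ΣM f lam

  distinctSum-partitions : ∀ b (g : ℕ → Carrier) n m → n ≤ b →
    ΣM (distinctSum g) (partitionsUpTo n m) ≈ weighted (g ↾ m) n m
  distinctSum-partitions b g zero m _ = identityˡ ε
  distinctSum-partitions b g (suc n) zero _ = ≈-trans
    (≈-reflexive (cong (ΣM (distinctSum g)) (partitionsUpTo-zero n)))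
    (≈-sym (weighted-ε (suc n) 0 (λ (1≤k , _) → ≈-reflexive (↾-zero g 1≤k))))
  distinctSum-partitions zero g (suc n) (suc m) ()
  distinctSum-partitions (suc b) g (suc n) (suc m) n<b+1 with suc m ≤? suc n
  ... | yes m<N = begin
    ΣM φ (partitionsUpTo N (suc m))
      ≈⟨ Σ-partitions-suc φ m<N ⟩
    ΣM φ (partitionsUpTo N m) ∙ ΣM (λ μ → φ (suc m ∷ μ)) Q
      ≈⟨ ∙-cong (distinctSum-partitions (suc b) g N m n<b+1) newBlock ⟩
    weighted (g ↾ m) N m ∙ (pUpTo R (suc m) · g (suc m) ∙ weighted (g ↾ m) R (suc m))
      ≈⟨ x∙yz≈xz∙y _ _ _ ⟩
    (weighted (g ↾ m) N m ∙ weighted (g ↾ m) R (suc m)) ∙ pUpTo R (suc m) · g (suc m)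
      ≈⟨ ∙-cong (weighted-suc (g ↾ m) m<N) (weighted-at g (suc m) (s≤s z≤n) m<N) ⟨
    weighted (g ↾ m) N (suc m) ∙ weighted (at (suc m) g) N (suc m)
      ≈⟨ weighted-∙ (g ↾ m) (at (suc m) g) N (suc m) ⟨
    weighted (λ k → (g ↾ m) k ∙ at (suc m) g k) N (suc m)
      ≈⟨ weighted-cong N (suc m) (λ {k} _ → ↾-suc g m k) ⟨
    weighted (g ↾ suc m) N (suc m) ∎
    where
    N : ℕ
    N = suc n
    R : ℕ
    R = N ∸ suc m
    Q : List (List ℕ)
    Q = partitionsUpTo R (suc m)
    φ : List ℕ → Carrier
    φ = distinctSum g
    -- The distinct parts of suc m ∷ μ are suc m and the distinct parts of μ other than suc m.
    newBlock : ΣM (λ μ → φ (suc m ∷ μ)) Q ≈ pUpTo R (suc m) · g (suc m) ∙ weighted (g ↾ m) R (suc m)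
    newBlock = begin
      ΣM (λ μ → φ (suc m ∷ μ)) Q
        ≈⟨ Σ-cong (λ μ → ∙-congˡ (Σ-filter (¬? ∘ (suc m ≟_)) g (distinctParts μ))) Q ⟩
      ΣM (λ μ → g (suc m) ∙ distinctSum (erase (suc m) g) μ) Q
        ≈⟨ Σ-prefix (g (suc m)) (distinctSum (erase (suc m) g)) Q ⟩
      pUpTo R (suc m) · g (suc m) ∙ ΣM (distinctSum (erase (suc m) g)) Q
        ≈⟨ ∙-congˡ (distinctSum-partitions b (erase (suc m) g) R (suc m) (≤-trans (m∸n≤m n m) (≤-pred n<b+1))) ⟩
      pUpTo R (suc m) · g (suc m) ∙ weighted (erase (suc m) g ↾ suc m) R (suc m)
        ≈⟨ ∙-congˡ (weighted-cong R (suc m) (λ {k} _ → ≈-reflexive (erase-↾ g m k))) ⟩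
      pUpTo R (suc m) · g (suc m) ∙ weighted (g ↾ m) R (suc m) ∎
  ... | no m≮N = begin
    ΣM φ (partitionsUpTo N (suc m))  ≡⟨ Σ-partitions-stable φ N≤m ⟩
    ΣM φ (partitionsUpTo N m)        ≈⟨ distinctSum-partitions (suc b) g N m n<b+1 ⟩
    weighted (g ↾ m) N m             ≈⟨ weighted-stable N≤m (λ (_ , k≤N) → ≈-reflexive
                                          (trans (↾-large g (≤-trans k≤N N≤m)) (sym (↾-large g (≤-trans k≤N (m≤n⇒m≤1+n N≤m)))))) ⟩
    weighted (g ↾ suc m) N (suc m)   ∎
    where
    N : ℕ
    N = suc n
    N≤m : N ≤ m
    N≤m = ≤-pred (≰⇒> m≮N)
    φ : List ℕ → Carrier
    φ = distinctSum g

  partSum-partitions : ∀ b (f : ℕ → Carrier) n m → n ≤ b →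
    ΣM (partSum f) (partitionsUpTo n m) ≈ weighted (divisorSum M (f ↾ m)) n m
  partSum-partitions b f zero m _ = identityˡ ε
  partSum-partitions b f (suc n) zero _ = ≈-trans
    (≈-reflexive (cong (ΣM (partSum f)) (partitionsUpTo-zero n)))
    (≈-sym (weighted-ε (suc n) 0 (λ {k} _ → divisorSum-↾-zero f k)))
  partSum-partitions zero f (suc n) (suc m) ()
  partSum-partitions (suc b) f (suc n) (suc m) n<b+1 with suc m ≤? suc n
  ... | yes m<N = begin
    ΣM ψ (partitionsUpTo N (suc m))
      ≈⟨ Σ-partitions-suc ψ m<N ⟩
    ΣM ψ (partitionsUpTo N m) ∙ ΣM (λ μ → f (suc m) ∙ ψ μ) Q
      ≈⟨ ∙-cong (partSum-partitions (suc b) f N m n<b+1) (Σ-prefix (f (suc m)) ψ Q) ⟩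
    weighted (w m) N m ∙ (pUpTo R (suc m) · f (suc m) ∙ ΣM ψ Q)
      ≈⟨ ∙-congˡ (∙-congˡ (partSum-partitions b f R (suc m) (≤-trans (m∸n≤m n m) (≤-pred n<b+1)))) ⟩
    weighted (w m) N m ∙ (pUpTo R (suc m) · f (suc m) ∙ weighted (w (suc m)) R (suc m))
      ≈⟨ assoc _ _ _ ⟨
    (weighted (w m) N m ∙ pUpTo R (suc m) · f (suc m)) ∙ weighted (w (suc m)) R (suc m)
      ≈⟨ ∙-congʳ (∙-congˡ (weighted-multiples N (f (suc m)) ≤-refl m<N)) ⟨
    (weighted (w m) N m ∙ weighted c N m) ∙ weighted (w (suc m)) R (suc m)
      ≈⟨ ∙-congʳ (weighted-∙ (w m) c N m) ⟨
    weighted (λ k → w m k ∙ c k) N m ∙ weighted (w (suc m)) R (suc m)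
      ≈⟨ ∙-congʳ (weighted-cong N m (λ (1≤k , _) → divisorSum-↾-suc f m 1≤k)) ⟨
    weighted (w (suc m)) N m ∙ weighted (w (suc m)) R (suc m)
      ≈⟨ weighted-suc (w (suc m)) m<N ⟨
    weighted (w (suc m)) N (suc m) ∎
    where
    N : ℕ
    N = suc n
    R : ℕ
    R = N ∸ suc m
    Q : List (List ℕ)
    Q = partitionsUpTo R (suc m)
    ψ : List ℕ → Carrier
    ψ = partSum f
    w : ℕ → ℕ → Carrier
    w j = divisorSum M (f ↾ j)
    c : ℕ → Carrier
    c = multiplesOf (suc m) (f (suc m))
  ... | no m≮N = begin
    ΣM ψ (partitionsUpTo N (suc m))          ≡⟨ Σ-partitions-stable ψ N≤m ⟩
    ΣM ψ (partitionsUpTo N m)                ≈⟨ partSum-partitions (suc b) f N m n<b+1 ⟩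
    weighted (divisorSum M (f ↾ m)) N m      ≈⟨ weighted-stable N≤m (λ (_ , k≤N) → ≈-trans
                                                  (divisorSum-↾-large f (≤-trans k≤N N≤m))
                                                  (≈-sym (divisorSum-↾-large f (≤-trans k≤N (m≤n⇒m≤1+n N≤m))))) ⟩
    weighted (divisorSum M (f ↾ suc m)) N (suc m) ∎
    where
    N : ℕ
    N = suc n
    N≤m : N ≤ m
    N≤m = ≤-pred (≰⇒> m≮N)
    ψ : List ℕ → Carrier
    ψ = partSum f

  times-· : ∀ k x → times M k x ≡ k · x
  times-· zero    x = refl
  times-· (suc k) x = cong (x ∙_) (times-· k x)

  pWeighted : (ℕ → Carrier) → ℕ → Carrier
  pWeighted w n = ΣM (λ k → times M (p (n ∸ k)) (w k)) (oneTo n)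

  distinctSum-identity : ∀ (g : ℕ → Carrier) n → ΣM (distinctSum g) (partitions n) ≈ pWeighted g n
  distinctSum-identity g n = begin
    ΣM (distinctSum g) (partitions n)        ≈⟨ distinctSum-partitions n g n n ≤-refl ⟩
    weighted (g ↾ n) n n                     ≈⟨ weighted-large (g ↾ n) {n} ≤-refl ⟩
    ΣM (λ k → p (n ∸ k) · (g ↾ n) k) (oneTo n) ≈⟨ Σ-oneTo-cong n (λ {k} (_ , k≤n) →
                                                  ≈-reflexive (trans (cong (p (n ∸ k) ·_) (↾-large g k≤n)) (sym (times-· (p (n ∸ k)) (g k))))) ⟩
    pWeighted g n                            ∎

  partSum-identity : ∀ (f : ℕ → Carrier) n → ΣM (partSum f) (partitions n) ≈ pWeighted (divisorSum M f) n
  partSum-identity f n = begin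
    ΣM (partSum f) (partitions n)            ≈⟨ partSum-partitions n f n n ≤-refl ⟩
    weighted (divisorSum M (f ↾ n)) n n      ≈⟨ weighted-large (divisorSum M (f ↾ n)) {n} ≤-refl ⟩
    ΣM (λ k → p (n ∸ k) · divisorSum M (f ↾ n) k) (oneTo n) ≈⟨ Σ-oneTo-cong n (λ {k} (_ , k≤n) →
                                                  ≈-trans (×-congʳ (p (n ∸ k)) (divisorSum-↾-large f k≤n)) (≈-reflexive (sym (times-· (p (n ∸ k)) (divisorSum M f k))))) ⟩
    pWeighted (divisorSum M f) n             ∎

theorem5 : {c ℓ : Level} (M : CommutativeMonoid c ℓ) (f : ℕ → CommutativeMonoid.Carrier M) (n : ℕ) → 1 ≤ n →
    (CommutativeMonoid._≈_ M
      (Σ M (map (λ lam → Σ M (map (divisorSum M f) (distinctParts lam))) (partitions n)))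
      (Σ M (map (λ lam → Σ M (map f lam)) (partitions n))))
    ×
    (CommutativeMonoid._≈_ M
      (Σ M (map (λ lam → Σ M (map f lam)) (partitions n)))
      (Σ M (map (λ k → times M (p (n ∸ k)) (divisorSum M f k)) (oneTo n))))
theorem5 M f n _ = ≈-trans (distinctSum-identity F n) (≈-sym (partSum-identity f n)) , partSum-identity f n
  where
  open Sums M
  open CommutativeMonoid M using () renaming (trans to ≈-trans; sym to ≈-sym)
  F : ℕ → CommutativeMonoid.Carrier M
  F = divisorSum M f
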